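{- For every integer $c\geq 2$ there exist a finite set $V$ and edge sets $E_1,E_2\subseteq\binom{V}{2}$ such that $\mathsf{c}((V,E_1))\geq c$ and $\mathsf{c}((V,E_2))\geq c$, and for every set of edges $R\subseteq\binom{V}{2}$ the multi-layer graph $(V,\{E_1,E_2\},R)$ has multi-layer cop number at most $2$.
   Context: For a simple graph $G$, $\mathsf{c}(G)$ is its (classical) cop number: the least number of cops that have a winning strategy in the cops and robber game on $G$ (cops placed first, then the robber, alternating turns starting with the cops, each agent stays or moves along one edge per turn, cops win if one occupies the robber's vertex). A multi-layer graph with designated layers is $(V,\{C_1,\dots,C_\tau\},R)$ with cop layers $C_i\subseteq\binom V2$ and robber layer $R\subseteq\binom V2$. In the multi-layer game with allocation $(k_1,\dots,k_\tau)$, $k_i$ cops are assigned to layer $C_i$ and move only along edges of $C_i$, the robber moves only along edges of $R$, otherwise the rules are as in the classical game. The multi-layer cop number is the least $k$ such that some allocation with $\sum_i k_i=k$ gives the cop player a winning strategy. -}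

module Defs where

open import Data.Nat using (ℕ; _<_; _≤_)
open import Data.Fin using (Fin)
open import Data.Bool using (Bool; true; false)
open import Data.Vec using (Vec; lookup; sum)
open import Data.Product using (Σ; ∃; _×_; _,_)
open import Data.Sum using (_⊎_)
open import Relation.Binary.PropositionalEquality using (_≡_)
open import Relation.Nullary using (¬_)

-- A set of edges on the vertex set V = Fin n, i.e. a subset of (V choose 2),
-- encoded as a symmetric irreflexive Boolean adjacency relation.
record EdgeSet (n : ℕ) : Set where
  field
    adj    : Fin n → Fin n → Bool
    sym    : ∀ u v → adj u v ≡ adj v u
    irrefl : ∀ u → adj u u ≡ false
open EdgeSet public

Move : {n : ℕ} → EdgeSet n → Fin n → Fin n → Set
Move E u v = (u ≡ v) ⊎ (adj E u v ≡ true)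

module Game {n : ℕ} (Cop : Set) (layer : Cop → EdgeSet n) (R : EdgeSet n) where

  Positions : Set
  Positions = Cop → Fin n

  Caught : Positions → Fin n → Set
  Caught cs r = ∃ λ c → cs c ≡ r

  -- CopWin cs r : it is the cops' turn, cops at cs, robber at r, and the
  -- cops have a strategy that captures the robber (in finitely many rounds)
  -- against every robber play.  (Inductive = well-founded strategy tree.)
  data CopWin (cs : Positions) (r : Fin n) : Set where
    captured : Caught cs r → CopWin cs r
    step     : (cs' : Positions) → (∀ c → Move (layer c) (cs c) (cs' c)) →
               (Caught cs' r ⊎ (∀ r' → Move R r r' → CopWin cs' r')) →
               CopWin cs r

  -- Cops are placed first, then the robber; then the cops move first.
  CopsWin : Set
  CopsWin = Σ Positions λ cs → ∀ r → CopWin cs r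

ClassicalCopsWin : {n : ℕ} → ℕ → EdgeSet n → Set
ClassicalCopsWin k E = Game.CopsWin (Fin k) (λ _ → E) E

CopNumber≥ : {n : ℕ} → EdgeSet n → ℕ → Set
CopNumber≥ E c = ∀ k → k < c → ¬ ClassicalCopsWin k E

-- Multi-layer game (Fin n, {C_1..C_τ}, R) with allocation (k_1..k_τ):
-- cops are pairs (i , j) with j : Fin k_i, moving along C_i.
MultiCopsWin : {n τ : ℕ} → Vec (EdgeSet n) τ → EdgeSet n → Vec ℕ τ → Set
MultiCopsWin {τ = τ} Cs R ks =
  Game.CopsWin (Σ (Fin τ) λ i → Fin (lookup ks i)) (λ c → lookup Cs (Data.Product.proj₁ c)) R

MultiCopNumber≤ : {n τ : ℕ} → Vec (EdgeSet n) τ → EdgeSet n → ℕ → Set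
MultiCopNumber≤ {τ = τ} Cs R m = ∃ λ (ks : Vec ℕ τ) → (sum ks ≤ m) × MultiCopsWin Cs R ks

-- Take two disjoint copies of c vertices and let E₁ be a star covering the
-- first copy and E₂ a star covering the second.  In (V, E₁) the c vertices of
-- the second copy are isolated, so a robber hiding on a cop-free one of them is
-- never caught, and fewer than c cops always leave one free; symmetrically for
-- E₂.  In the two-layer game one cop sits at each centre: wherever the robber
-- appears, the centre of its copy is adjacent to it.
module Submission where

open import Defs hiding (sym)
open import Data.Nat using (ℕ; _≤_; _+_; suc; s≤s; z≤n)
open import Data.Product using (Σ; _×_; _,_; proj₁; proj₂; ∃; ∃₂)
open import Data.Vec using (_∷_; []; lookup)

open import Data.Bool using (Bool; true; false; _∧_; _∨_; not)
open import Data.Bool.Properties using (∨-comm; ∧-zeroʳ)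
open import Data.Empty using (⊥; ⊥-elim)
open import Data.Fin using (Fin; _<_; zero; _↑ˡ_; _↑ʳ_; splitAt; _≟_)
open import Data.Fin.Properties using (any?; pigeonhole; <⇒≢; splitAt-↑ˡ; splitAt-↑ʳ; ↑ˡ-injective; ↑ʳ-injective)
open import Data.Sum using (_⊎_; inj₁; inj₂; [_,_]′)
open import Function using (_∘_; const)
open import Function.Definitions using (Injective)
open import Relation.Binary.PropositionalEquality using (_≡_; _≢_; refl; sym; trans; cong; subst)
open import Relation.Nullary using (¬_; yes; no; does)
open import Relation.Nullary.Decidable using (dec-false)

private
  variable
    n : ℕ

Isolated : EdgeSet n → Fin n → Set
Isolated E v = ∀ u → adj E u v ≡ false

Move-to-isolated : (E : EdgeSet n) {u v : Fin n} → Isolated E v → Move E u v → u ≡ v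
Move-to-isolated E isolated (inj₁ u≡v)  = u≡v
Move-to-isolated E {u} isolated (inj₂ uv) with () ← trans (sym uv) (isolated u)

module _ (x : Fin n) (leaf : Fin n → Bool) where
  private
    spoke : Fin n → Fin n → Bool
    spoke u v = does (u ≟ x) ∧ not (does (v ≟ x)) ∧ leaf v

  star : EdgeSet n
  adj star u v = spoke u v ∨ spoke v u
  EdgeSet.sym star u v = ∨-comm (spoke u v) (spoke v u)
  irrefl star u with does (u ≟ x)
  ... | true  = refl
  ... | false = refl

  star-Move-from-centre : ∀ {v} → leaf v ≡ true → Move star x v
  star-Move-from-centre {v} leaf-v with v ≟ x | x ≟ x
  ... | yes v≡x | _     = inj₁ (sym v≡x)
  ... | no _    | yes _ rewrite leaf-v = inj₂ refl
  ... | no _    | no x≢x = ⊥-elim (x≢x refl)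

  star-isolated : ∀ {v} → v ≢ x → leaf v ≡ false → Isolated star v
  star-isolated {v} v≢x leaf-v u rewrite dec-false (v ≟ x) v≢x | leaf-v | ∧-zeroʳ (does (u ≟ x)) = refl

module _ {Cop : Set} (layer : Cop → EdgeSet n) (R : EdgeSet n) where
  open Game Cop layer R

  robber-escapes-at-isolated : {b : Fin n} → (∀ c → Isolated (layer c) b) →
                               {cs : Positions} → (∀ c → cs c ≢ b) → ¬ CopWin cs b
  robber-escapes-at-isolated {b} isolated = escape
    where
    stays-off : {cs cs' : Positions} → (∀ c → Move (layer c) (cs c) (cs' c)) →
                (∀ c → cs c ≢ b) → ∀ c → cs' c ≢ b
    stays-off moves off c cs'c≡b =
      off c (Move-to-isolated (layer c) (isolated c) (subst (Move (layer c) _) cs'c≡b (moves c)))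

    escape : {cs : Positions} → (∀ c → cs c ≢ b) → ¬ CopWin cs b
    escape off (captured (c , cs≡b))               = off c cs≡b
    escape off (step cs' moves (inj₁ (c , cs'≡b))) = stays-off moves off c cs'≡b
    escape off (step cs' moves (inj₂ continue))    = escape (stays-off moves off) (continue b (inj₁ refl))

module _ (E : EdgeSet n) where
  open Game

  occupied-if-CopWin : ∀ {k} {cs : Fin k → Fin n} {b : Fin n} → Isolated E b →
                       CopWin (Fin k) (λ _ → E) E cs b → ∃ λ c → cs c ≡ b
  occupied-if-CopWin {cs = cs} {b} isolated win with any? (λ c → cs c ≟ b)
  ... | yes occupied = occupied
  ... | no free      =
    ⊥-elim (robber-escapes-at-isolated (λ _ → E) E (λ _ → isolated) (λ c e → free (c , e)) win)

  CopNumber≥-of-isolated : ∀ c (g : Fin c → Fin n) → Injective _≡_ _≡_ g →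
                           (∀ i → Isolated E (g i)) → CopNumber≥ E c
  CopNumber≥-of-isolated c g g-injective isolated k k<c (cs , win) =
    two-guards-same-cop (pigeonhole k<c (proj₁ ∘ guard))
    where
    guard : ∀ i → ∃ λ c → cs c ≡ g i
    guard i = occupied-if-CopWin (isolated i) (win (g i))

    two-guards-same-cop : (∃₂ λ i j → i < j × proj₁ (guard i) ≡ proj₁ (guard j)) → ⊥
    two-guards-same-cop (i , j , i<j , same-cop) =
      <⇒≢ i<j (g-injective (trans (sym (proj₂ (guard i))) (trans (cong cs same-cop) (proj₂ (guard j)))))

module _ (E₁ E₂ R : EdgeSet n) (x₁ x₂ : Fin n) where
  private
    Cop : Set
    Cop = Σ (Fin 2) λ i → Fin (lookup (1 ∷ 1 ∷ []) i)

    open Game Cop (λ c → lookup (E₁ ∷ E₂ ∷ []) (proj₁ c)) R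

    place : Fin n → Fin n → Positions
    place a₁ a₂ (zero , _)          = a₁
    place a₁ a₂ (Fin.suc zero , _) = a₂

    catch : ∀ r → Move E₁ x₁ r ⊎ Move E₂ x₂ r → CopWin (place x₁ x₂) r
    catch r (inj₁ reach) = step (place r x₂) moves (inj₁ ((zero , zero) , refl))
      where
      moves : ∀ c → Move (lookup (E₁ ∷ E₂ ∷ []) (proj₁ c)) (place x₁ x₂ c) (place r x₂ c)
      moves (zero , _)          = reach
      moves (Fin.suc zero , _) = inj₁ refl
    catch r (inj₂ reach) = step (place x₁ r) moves (inj₁ ((Fin.suc zero , zero) , refl))
      where
      moves : ∀ c → Move (lookup (E₁ ∷ E₂ ∷ []) (proj₁ c)) (place x₁ x₂ c) (place x₁ r c)
      moves (zero , _)          = inj₁ refl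
      moves (Fin.suc zero , _) = reach

  MultiCopNumber≤2-of-dominating : (∀ v → Move E₁ x₁ v ⊎ Move E₂ x₂ v) →
                                   MultiCopNumber≤ (E₁ ∷ E₂ ∷ []) R 2
  MultiCopNumber≤2-of-dominating dominating =
    1 ∷ 1 ∷ [] , s≤s (s≤s z≤n) , place x₁ x₂ , λ r → catch r (dominating r)

module TwinStars {c : ℕ} (o : Fin c) where
  isLeft : Fin c ⊎ Fin c → Bool
  isLeft = [ const true , const false ]′

  inLeft : Fin (c + c) → Bool
  inLeft = isLeft ∘ splitAt c

  left-centre right-centre : Fin (c + c)
  left-centre  = o ↑ˡ c
  right-centre = c ↑ʳ o

  left-star right-star : EdgeSet (c + c)
  left-star  = star left-centre inLeft
  right-star = star right-centre (not ∘ inLeft)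

  ↑ˡ≢↑ʳ : ∀ (i j : Fin c) → i ↑ˡ c ≢ c ↑ʳ j
  ↑ˡ≢↑ʳ i j eq with () ← trans (sym (splitAt-↑ˡ c i c)) (trans (cong (splitAt c) eq) (splitAt-↑ʳ c c j))

  right-isolated-in-left-star : ∀ i → Isolated left-star (c ↑ʳ i)
  right-isolated-in-left-star i =
    star-isolated left-centre inLeft (↑ˡ≢↑ʳ o i ∘ sym) (cong isLeft (splitAt-↑ʳ c c i))

  left-isolated-in-right-star : ∀ i → Isolated right-star (i ↑ˡ c)
  left-isolated-in-right-star i =
    star-isolated right-centre (not ∘ inLeft) (↑ˡ≢↑ʳ i o) (cong (not ∘ isLeft) (splitAt-↑ˡ c i c))

  centres-dominating : ∀ v → Move left-star left-centre v ⊎ Move right-star right-centre v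
  centres-dominating v = by-side (splitAt c v) refl
    where
    by-side : ∀ s → splitAt c v ≡ s → Move left-star left-centre v ⊎ Move right-star right-centre v
    by-side (inj₁ _) side = inj₁ (star-Move-from-centre left-centre inLeft (cong isLeft side))
    by-side (inj₂ _) side = inj₂ (star-Move-from-centre right-centre (not ∘ inLeft) (cong (not ∘ isLeft) side))

corollary3p7 : (c : ℕ) → 2 ≤ c →
    Σ ℕ λ n → Σ (EdgeSet n) λ E₁ → Σ (EdgeSet n) λ E₂ →
      CopNumber≥ E₁ c × CopNumber≥ E₂ c ×
      ((R : EdgeSet n) → MultiCopNumber≤ (E₁ ∷ E₂ ∷ []) R 2)
corollary3p7 c@(suc _) _ =
  c + c , left-star , right-star ,
  CopNumber≥-of-isolated left-star c (c ↑ʳ_) (↑ʳ-injective c _ _) right-isolated-in-left-star ,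
  CopNumber≥-of-isolated right-star c (_↑ˡ c) (↑ˡ-injective c _ _) left-isolated-in-right-star ,
  λ R → MultiCopNumber≤2-of-dominating left-star right-star R left-centre right-centre centres-dominating
  where open TwinStars {c} zero
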